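{- Let $G$ be a self-complementary graph with an antimorphism $\tau$ that is the product of two disjoint circular permutations (whose supports together are $V(G)$), one of them of length $4$. Then at least one of the following holds: $G$ contains the cycle $C_5$ as an induced subgraph; $G$ has a skew partition; $G$ has a symmetric partition.
   Context: Graphs are finite, simple and undirected. An antimorphism of $G$ is a bijection $\tau:V(G)\to V(G)$ such that for all distinct $a,b$, $ab\in E(G)$ if and only if $\tau(a)\tau(b)\notin E(G)$; $G$ is self-complementary if it has an antimorphism. A skew partition of $G$ is a partition $(W,X,Y,Z)$ of $V(G)$ into four non-empty sets such that there are no edges between $W$ and $X$ and every vertex of $Y$ is adjacent to every vertex of $Z$. A symmetric partition of $G$ is a partition $(W,X,Y,Z)$ of $V(G)$ into four non-empty sets such that there are no edges between $W$ and $Z$, no edges between $X$ and $Y$, every vertex of $W$ is adjacent to every vertex of $X$, and every vertex of $Y$ is adjacent to every vertex of $Z$. -}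

module Defs where

open import Data.Nat using (ℕ; zero; suc)
open import Data.Fin using (Fin; zero; suc; _≟_)
open import Data.Fin.Permutation using (Permutation′; _⟨$⟩ʳ_)
open import Data.Bool using (Bool; true; false)
open import Data.Product using (Σ; ∃; _×_; _,_)
open import Data.Sum using (_⊎_)
open import Relation.Nullary using (¬_)
open import Relation.Binary.PropositionalEquality using (_≡_; _≢_)

record Graph (n : ℕ) : Set where
  field
    adj   : Fin n → Fin n → Bool
    sym   : ∀ u v → adj u v ≡ adj v u
    irrefl : ∀ v → adj v v ≡ false
open Graph public

Edge : ∀ {n} → Graph n → Fin n → Fin n → Set
Edge G u v = adj G u v ≡ true

IsAntimorphism : ∀ {n} → Graph n → Permutation′ n → Set
IsAntimorphism G τ =
  ∀ a b → a ≢ b → (Edge G a b → ¬ Edge G (τ ⟨$⟩ʳ a) (τ ⟨$⟩ʳ b))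
                × (¬ Edge G (τ ⟨$⟩ʳ a) (τ ⟨$⟩ʳ b) → Edge G a b)

iter : ∀ {n} → Permutation′ n → ℕ → Fin n → Fin n
iter τ zero    v = v
iter τ (suc k) v = τ ⟨$⟩ʳ iter τ k v

-- τ is the product of two disjoint cyclic permutations whose supports
-- together cover V, one of them of length 4: there are vertices a, b such
-- that the τ-orbit of a has exactly 4 elements and every vertex lies in the
-- τ-orbit of a or in the τ-orbit of b, the two orbits being disjoint.
TwoCyclesOneOfLength4 : ∀ {n} → Permutation′ n → Set
TwoCyclesOneOfLength4 {n} τ = Σ (Fin n) λ a → Σ (Fin n) λ b →
    (iter τ 4 a ≡ a)
  × (∀ (i j : Fin 4) → i ≢ j → iter τ (Data.Fin.toℕ i) a ≢ iter τ (Data.Fin.toℕ j) a)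
  × (∀ i j → iter τ i a ≢ iter τ j b)
  × (∀ v → (∃ λ i → v ≡ iter τ i a) ⊎ (∃ λ j → v ≡ iter τ j b))

c5adj : Fin 5 → Fin 5 → Bool
c5adj i j with Data.Fin.toℕ i | Data.Fin.toℕ j
... | x | y = c x y
  where
  c : ℕ → ℕ → Bool
  c 0 1 = true
  c 1 0 = true
  c 1 2 = true
  c 2 1 = true
  c 2 3 = true
  c 3 2 = true
  c 3 4 = true
  c 4 3 = true
  c 4 0 = true
  c 0 4 = true
  c _ _ = false

HasInducedC5 : ∀ {n} → Graph n → Set
HasInducedC5 {n} G = Σ (Fin 5 → Fin n) λ f →
    (∀ i j → f i ≡ f j → i ≡ j)
  × (∀ i j → adj G (f i) (f j) ≡ c5adj i j)

-- the four parts W, X, Y, Z are the preimages of 0,1,2,3 under p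
W X Y Z : Fin 4
W = zero
X = suc zero
Y = suc (suc zero)
Z = suc (suc (suc zero))

AllNonEmpty : ∀ {n} → (Fin n → Fin 4) → Set
AllNonEmpty {n} p = ∀ k → ∃ λ (v : Fin n) → p v ≡ k

NoEdges : ∀ {n} → Graph n → (Fin n → Fin 4) → Fin 4 → Fin 4 → Set
NoEdges G p k l = ∀ u v → p u ≡ k → p v ≡ l → ¬ Edge G u v

Complete : ∀ {n} → Graph n → (Fin n → Fin 4) → Fin 4 → Fin 4 → Set
Complete G p k l = ∀ u v → p u ≡ k → p v ≡ l → Edge G u v

HasSkewPartition : ∀ {n} → Graph n → Set
HasSkewPartition {n} G = Σ (Fin n → Fin 4) λ p →
  AllNonEmpty p × NoEdges G p W X × Complete G p Y Z

HasSymmetricPartition : ∀ {n} → Graph n → Set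
HasSymmetricPartition {n} G = Σ (Fin n → Fin 4) λ p →
  AllNonEmpty p × NoEdges G p W Z × NoEdges G p X Y
  × Complete G p W X × Complete G p Y Z

module Submission where

-- Since τ complements adjacency, the 4-cycle a, τa, τ²a, τ³a induces a P4, fixed by
-- x = [a ~ τa] and y = [a ~ τ²a]. Off that cycle τ acts on the vector of adjacencies
-- to it (the profile) by a negated rotation, which has period 4, so the vertices of
-- the second cycle have at most four profiles, all determined by the profile of b.
-- Thus G is known except for edges inside the second cycle. For each of the 64 values
-- of x, y and the profile of b, a certificate is checked by evaluation: an induced C5
-- on the 4-cycle and b, or a skew or symmetric partition that puts each vertex of the
-- second cycle in a part determined by its profile and never constrains a pair of them.

open import Defs hiding (sym)
open import Data.Bool using (Bool; true; false; not)
open import Data.Bool.Properties using (not-involutive; not-¬; ¬-not) renaming (_≟_ to _≟ᵇ_)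
open import Data.Fin using (Fin; toℕ; _≟_)
open import Data.Fin.Patterns using (0F; 1F; 2F; 3F; 4F)
open import Data.Fin.Permutation using (Permutation′; _⟨$⟩ʳ_)
open import Data.Fin.Properties using (all?; any?)
open import Data.Maybe using (Maybe; just; nothing)
open import Data.Maybe.Properties using () renaming (≡-dec to ≡-decᵐ)
open import Data.Nat using (ℕ; zero; suc)
open import Data.Product using (Σ; ∃; _×_; _,_; proj₁; proj₂)
open import Data.Sum using (_⊎_; inj₁; inj₂; [_,_])
open import Data.Vec using (Vec; []; _∷_; lookup; tabulate)
open import Data.Vec.Properties using (lookup∘tabulate) renaming (≡-dec to ≡-decᵛ)
open import Function using (_∘_)
open import Relation.Nullary using (Dec; yes; no; contradiction)
open import Relation.Nullary.Decidable
  using (True; toWitness; map′; ¬?; _×-dec_; _⊎-dec_; _→-dec_)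
open import Relation.Binary.PropositionalEquality
  using (_≡_; _≢_; refl; sym; trans; cong; cong₂)

iterate : {A : Set} → (A → A) → ℕ → A → A
iterate f zero    x = x
iterate f (suc k) x = f (iterate f k x)

period-4-values : {A : Set} (f : A → A) (g : ℕ → A) →
  (∀ j → g (suc j) ≡ f (g j)) → g 4 ≡ g 0 →
  ∀ j → ∃ λ (c : Fin 4) → g j ≡ g (toℕ c)
period-4-values f g step period zero = 0F , refl
period-4-values f g step period (suc j) =
  let (c , gj≡gc) = period-4-values f g step period j
  in next c (trans (step j) (cong f gj≡gc))
  where
  next : ∀ c → g (suc j) ≡ f (g (toℕ c)) →
    ∃ λ (c′ : Fin 4) → g (suc j) ≡ g (toℕ c′)
  next 0F e = 1F , trans e (sym (step 0))
  next 1F e = 2F , trans e (sym (step 1))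
  next 2F e = 3F , trans e (sym (step 2))
  next 3F e = 0F , trans e (trans (sym (step 3)) period)

c5adj-irrefl : ∀ i → c5adj i i ≡ false
c5adj-irrefl 0F = refl
c5adj-irrefl 1F = refl
c5adj-irrefl 2F = refl
c5adj-irrefl 3F = refl
c5adj-irrefl 4F = refl

c5adj-separates : ∀ i j → (∀ k → c5adj k i ≡ c5adj k j) → i ≡ j
c5adj-separates = toWitness {a? = all? λ i → all? λ j →
  all? (λ k → c5adj k i ≟ᵇ c5adj k j) →-dec i ≟ j} _

-- Injectivity is automatic: distinct vertices of C5 have distinct neighbourhoods.
induced-C5 : ∀ {n} (G : Graph n) (g : Fin 5 → Fin n) →
  (∀ i j → i ≢ j → adj G (g i) (g j) ≡ c5adj i j) → HasInducedC5 G
induced-C5 G g exact = g , injective , adj≡c5adj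
  where
  adj≡c5adj : ∀ i j → adj G (g i) (g j) ≡ c5adj i j
  adj≡c5adj i j with i ≟ j
  ... | yes refl = trans (irrefl G (g i)) (sym (c5adj-irrefl i))
  ... | no i≢j   = exact i j i≢j

  injective : ∀ i j → g i ≡ g j → i ≡ j
  injective i j gi≡gj = c5adj-separates i j λ k →
    trans (sym (adj≡c5adj k i)) (trans (cong (adj G (g k)) gi≡gj) (adj≡c5adj k j))

antimorphism-flips : ∀ {n} {G : Graph n} {τ : Permutation′ n} → IsAntimorphism G τ →
  ∀ {u v} → u ≢ v → adj G (τ ⟨$⟩ʳ u) (τ ⟨$⟩ʳ v) ≡ not (adj G u v)
antimorphism-flips {G = G} anti {u} {v} u≢v with adj G u v in e
... | true  = ¬-not (proj₁ (anti u v u≢v) e)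
... | false = ¬-not λ image-false → not-¬ e (proj₂ (anti u v u≢v) (not-¬ image-false))

Onto : {T : Set} → (T → Fin 4) → Set
Onto q = ∀ k → ∃ λ t → q t ≡ k

module _ {T : Set} (M : T → T → Maybe Bool) where

  ModelC5 : (Fin 5 → T) → Set
  ModelC5 f = ∀ i j → i ≢ j → M (f i) (f j) ≡ just (c5adj i j)

  Forced : (T → Fin 4) → Fin 4 → Fin 4 → Bool → Set
  Forced q k l w = ∀ s t → q s ≡ k → q t ≡ l → M s t ≡ just w

  ModelSkew : (T → Fin 4) → Set
  ModelSkew q = Onto q × Forced q W X false × Forced q Y Z true

  ModelSymmetric : (T → Fin 4) → Set
  ModelSymmetric q = Onto q × Forced q W Z false × Forced q X Y false
                   × Forced q W X true × Forced q Y Z true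

-- M s t ≡ just w: vertices of types s and t are adjacent iff w; nothing: no information.
module Lifting {n} (G : Graph n) {T : Set} (M : T → T → Maybe Bool)
  (Realizes : Fin n → T → Set)
  (sound : ∀ {u v s t w} → Realizes u s → Realizes v t →
           M s t ≡ just w → adj G u v ≡ w)
  (realizer : ∀ t → ∃ λ v → Realizes v t)
  (classify : ∀ v → Σ T (Realizes v)) where

  lift-C5 : (f : Fin 5 → T) → ModelC5 M f → HasInducedC5 G
  lift-C5 f model = induced-C5 G (proj₁ ∘ realizer ∘ f) λ i j i≢j →
    sound (proj₂ (realizer (f i))) (proj₂ (realizer (f j))) (model i j i≢j)

  module _ (q : T → Fin 4)
    (q-respects : ∀ {v s t} → Realizes v s → Realizes v t → q s ≡ q t) where

    part : Fin n → Fin 4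
    part v = q (proj₁ (classify v))

    lift-onto : Onto q → AllNonEmpty part
    lift-onto onto k =
      let (t , qt≡k) = onto k
          (v , v⊨t) = realizer t
      in v , trans (q-respects (proj₂ (classify v)) v⊨t) qt≡k

    lift-forced : ∀ {k l w} → Forced M q k l w →
      ∀ u v → part u ≡ k → part v ≡ l → adj G u v ≡ w
    lift-forced forced u v pu pv =
      sound (proj₂ (classify u)) (proj₂ (classify v)) (forced _ _ pu pv)

    lift-no-edges : ∀ {k l} → Forced M q k l false → NoEdges G part k l
    lift-no-edges forced u v pu pv = not-¬ (lift-forced forced u v pu pv)

    lift-skew : ModelSkew M q → HasSkewPartition G
    lift-skew (onto , wx , yz) =
      part , lift-onto onto , lift-no-edges wx , lift-forced yz

    lift-symmetric : ModelSymmetric M q → HasSymmetricPartition G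
    lift-symmetric (onto , wz , xy , wx , yz) =
      part , lift-onto onto , lift-no-edges wz , lift-no-edges xy , lift-forced wx , lift-forced yz

Profile : Set
Profile = Vec Bool 4

rotate-not : Profile → Profile
rotate-not (t₀ ∷ t₁ ∷ t₂ ∷ t₃ ∷ []) = not t₃ ∷ not t₀ ∷ not t₁ ∷ not t₂ ∷ []

rotate-not⁴ : ∀ t → iterate rotate-not 4 t ≡ t
rotate-not⁴ (t₀ ∷ t₁ ∷ t₂ ∷ t₃ ∷ []) =
  cong₂ _∷_ (not⁴ t₀) (cong₂ _∷_ (not⁴ t₁)
    (cong₂ _∷_ (not⁴ t₂) (cong (_∷ []) (not⁴ t₃))))
  where
  not⁴ : ∀ x → not (not (not (not x))) ≡ x
  not⁴ x = trans (not-involutive (not (not x))) (not-involutive x)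

rotations : Profile → Fin 4 → Profile
rotations t c = iterate rotate-not (toℕ c) t

-- The 4-cycle a₀a₁a₂a₃ of an antimorphism induces a P4: its adjacencies alternate
-- along the cycle, starting from x = a₀a₁ and y = a₀a₂.
cycleAdj : Bool → Bool → Fin 4 → Fin 4 → Bool
cycleAdj x y 0F 0F = false
cycleAdj x y 0F 1F = x
cycleAdj x y 0F 2F = y
cycleAdj x y 0F 3F = not x
cycleAdj x y 1F 0F = x
cycleAdj x y 1F 1F = false
cycleAdj x y 1F 2F = not x
cycleAdj x y 1F 3F = not y
cycleAdj x y 2F 0F = y
cycleAdj x y 2F 1F = not x
cycleAdj x y 2F 2F = false
cycleAdj x y 2F 3F = x
cycleAdj x y 3F 0F = not x
cycleAdj x y 3F 1F = not y
cycleAdj x y 3F 2F = x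
cycleAdj x y 3F 3F = false

-- cyc i is the vertex τⁱ a; orb c stands for the vertices of the second cycle
-- whose profile is that of τᶜ b.
data VertexType : Set where
  cyc orb : Fin 4 → VertexType

modelAdj : Bool → Bool → Profile → VertexType → VertexType → Maybe Bool
modelAdj x y t (cyc i) (cyc j) = just (cycleAdj x y i j)
modelAdj x y t (cyc i) (orb c) = just (lookup (rotations t c) i)
modelAdj x y t (orb c) (cyc i) = just (lookup (rotations t c) i)
modelAdj x y t (orb c) (orb d) = nothing

all-types? : {P : VertexType → Set} → (∀ t → Dec (P t)) → Dec (∀ t → P t)
all-types? P? = map′ (λ (onCyc , onOrb) → λ { (cyc i) → onCyc i ; (orb c) → onOrb c })
                     (λ p → p ∘ cyc , p ∘ orb)
                     (all? (P? ∘ cyc) ×-dec all? (P? ∘ orb))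

any-type? : {P : VertexType → Set} → (∀ t → Dec (P t)) → Dec (∃ P)
any-type? P? = map′ [ (λ (i , p) → cyc i , p) , (λ (c , p) → orb c , p) ]
                    (λ { (cyc i , p) → inj₁ (i , p) ; (orb c , p) → inj₂ (c , p) })
                    (any? (P? ∘ cyc) ⊎-dec any? (P? ∘ orb))

module _ (M : VertexType → VertexType → Maybe Bool) where

  modelC5? : (f : Fin 5 → VertexType) → Dec (ModelC5 M f)
  modelC5? f = all? λ i → all? λ j →
    ¬? (i ≟ j) →-dec ≡-decᵐ _≟ᵇ_ (M (f i) (f j)) (just (c5adj i j))

  module _ (q : VertexType → Fin 4) where

    forced? : ∀ k l w → Dec (Forced M q k l w)
    forced? k l w = all-types? λ s → all-types? λ t →
      q s ≟ k →-dec q t ≟ l →-dec ≡-decᵐ _≟ᵇ_ (M s t) (just w)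

    onto? : Dec (Onto q)
    onto? = all? λ k → any-type? λ t → q t ≟ k

    skew? : Dec (ModelSkew M q)
    skew? = onto? ×-dec forced? W X false ×-dec forced? Y Z true

    symmetric? : Dec (ModelSymmetric M q)
    symmetric? = onto? ×-dec forced? W Z false ×-dec forced? X Y false
               ×-dec forced? W X true ×-dec forced? Y Z true

Compatible : Profile → Vec (Fin 4) 4 → Set
Compatible t orbPart =
  ∀ c d → rotations t c ≡ rotations t d → lookup orbPart c ≡ lookup orbPart d

compatible? : ∀ t orbPart → Dec (Compatible t orbPart)
compatible? t orbPart = all? λ c → all? λ d →
  ≡-decᵛ _≟ᵇ_ (rotations t c) (rotations t d) →-dec lookup orbPart c ≟ lookup orbPart d

partition : Vec (Fin 4) 4 → Vec (Fin 4) 4 → VertexType → Fin 4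
partition cycPart orbPart (cyc i) = lookup cycPart i
partition cycPart orbPart (orb c) = lookup orbPart c

data Certificate (x y : Bool) (t : Profile) : Set where
  c5 : (f : Vec VertexType 5) → True (modelC5? (modelAdj x y t) (lookup f)) → Certificate x y t
  skew : (cycPart orbPart : Vec (Fin 4) 4) →
    True (compatible? t orbPart ×-dec skew? (modelAdj x y t) (partition cycPart orbPart)) →
    Certificate x y t
  symmetric : (cycPart orbPart : Vec (Fin 4) 4) →
    True (compatible? t orbPart ×-dec symmetric? (modelAdj x y t) (partition cycPart orbPart)) →
    Certificate x y t

-- Each _ is the trivial proof of True, accepted once the decision procedure evaluates to yes.
certificate : ∀ x y t → Certificate x y t
certificate false false (false ∷ false ∷ false ∷ false ∷ []) = skew (W ∷ W ∷ W ∷ Y ∷ []) (X ∷ Z ∷ X ∷ Z ∷ []) _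
certificate false false (true ∷ false ∷ false ∷ false ∷ []) = skew (Y ∷ W ∷ Y ∷ W ∷ []) (X ∷ Z ∷ X ∷ Z ∷ []) _
certificate false false (false ∷ true ∷ false ∷ false ∷ []) = skew (W ∷ X ∷ X ∷ Y ∷ []) (X ∷ Z ∷ X ∷ X ∷ []) _
certificate false false (true ∷ true ∷ false ∷ false ∷ []) = symmetric (W ∷ Z ∷ Y ∷ X ∷ []) (X ∷ X ∷ Z ∷ Z ∷ []) _
certificate false false (false ∷ false ∷ true ∷ false ∷ []) = skew (Y ∷ W ∷ Y ∷ W ∷ []) (X ∷ Z ∷ X ∷ Z ∷ []) _
certificate false false (true ∷ false ∷ true ∷ false ∷ []) = c5 (cyc 0F ∷ cyc 3F ∷ cyc 1F ∷ cyc 2F ∷ orb 0F ∷ []) _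
certificate false false (false ∷ true ∷ true ∷ false ∷ []) = symmetric (W ∷ Z ∷ Y ∷ X ∷ []) (Z ∷ X ∷ X ∷ Z ∷ []) _
certificate false false (true ∷ true ∷ true ∷ false ∷ []) = skew (Y ∷ W ∷ Y ∷ W ∷ []) (Z ∷ X ∷ Z ∷ X ∷ []) _
certificate false false (false ∷ false ∷ false ∷ true ∷ []) = skew (W ∷ X ∷ X ∷ Y ∷ []) (X ∷ X ∷ X ∷ Z ∷ []) _
certificate false false (true ∷ false ∷ false ∷ true ∷ []) = symmetric (W ∷ Z ∷ Y ∷ X ∷ []) (X ∷ Z ∷ Z ∷ X ∷ []) _
certificate false false (false ∷ true ∷ false ∷ true ∷ []) = skew (W ∷ X ∷ X ∷ Y ∷ []) (Z ∷ Z ∷ Z ∷ Z ∷ []) _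
certificate false false (true ∷ true ∷ false ∷ true ∷ []) = skew (W ∷ X ∷ X ∷ Y ∷ []) (Z ∷ X ∷ X ∷ X ∷ []) _
certificate false false (false ∷ false ∷ true ∷ true ∷ []) = symmetric (W ∷ Z ∷ Y ∷ X ∷ []) (Z ∷ Z ∷ X ∷ X ∷ []) _
certificate false false (true ∷ false ∷ true ∷ true ∷ []) = skew (Y ∷ W ∷ Y ∷ W ∷ []) (Z ∷ X ∷ Z ∷ X ∷ []) _
certificate false false (false ∷ true ∷ true ∷ true ∷ []) = skew (W ∷ X ∷ X ∷ Y ∷ []) (X ∷ X ∷ Z ∷ X ∷ []) _
certificate false false (true ∷ true ∷ true ∷ true ∷ []) = skew (W ∷ W ∷ W ∷ Y ∷ []) (Z ∷ X ∷ Z ∷ X ∷ []) _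
certificate false true  (false ∷ false ∷ false ∷ false ∷ []) = skew (W ∷ W ∷ W ∷ Y ∷ []) (X ∷ Z ∷ X ∷ Z ∷ []) _
certificate false true  (true ∷ false ∷ false ∷ false ∷ []) = skew (W ∷ X ∷ Y ∷ W ∷ []) (W ∷ W ∷ W ∷ Z ∷ []) _
certificate false true  (false ∷ true ∷ false ∷ false ∷ []) = skew (W ∷ Y ∷ W ∷ Y ∷ []) (X ∷ Z ∷ X ∷ Z ∷ []) _
certificate false true  (true ∷ true ∷ false ∷ false ∷ []) = symmetric (W ∷ Z ∷ Y ∷ X ∷ []) (X ∷ X ∷ Z ∷ Z ∷ []) _
certificate false true  (false ∷ false ∷ true ∷ false ∷ []) = skew (W ∷ X ∷ Y ∷ W ∷ []) (W ∷ Z ∷ W ∷ W ∷ []) _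
certificate false true  (true ∷ false ∷ true ∷ false ∷ []) = skew (W ∷ X ∷ Y ∷ W ∷ []) (Z ∷ Z ∷ Z ∷ Z ∷ []) _
certificate false true  (false ∷ true ∷ true ∷ false ∷ []) = symmetric (W ∷ Z ∷ Y ∷ X ∷ []) (Z ∷ X ∷ X ∷ Z ∷ []) _
certificate false true  (true ∷ true ∷ true ∷ false ∷ []) = skew (W ∷ X ∷ Y ∷ W ∷ []) (Z ∷ W ∷ W ∷ W ∷ []) _
certificate false true  (false ∷ false ∷ false ∷ true ∷ []) = skew (W ∷ Y ∷ W ∷ Y ∷ []) (X ∷ Z ∷ X ∷ Z ∷ []) _
certificate false true  (true ∷ false ∷ false ∷ true ∷ []) = symmetric (W ∷ Z ∷ Y ∷ X ∷ []) (X ∷ Z ∷ Z ∷ X ∷ []) _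
certificate false true  (false ∷ true ∷ false ∷ true ∷ []) = c5 (cyc 0F ∷ cyc 2F ∷ cyc 1F ∷ orb 0F ∷ cyc 3F ∷ []) _
certificate false true  (true ∷ true ∷ false ∷ true ∷ []) = skew (W ∷ Y ∷ W ∷ Y ∷ []) (Z ∷ X ∷ Z ∷ X ∷ []) _
certificate false true  (false ∷ false ∷ true ∷ true ∷ []) = symmetric (W ∷ Z ∷ Y ∷ X ∷ []) (Z ∷ Z ∷ X ∷ X ∷ []) _
certificate false true  (true ∷ false ∷ true ∷ true ∷ []) = skew (W ∷ X ∷ Y ∷ W ∷ []) (W ∷ W ∷ Z ∷ W ∷ []) _
certificate false true  (false ∷ true ∷ true ∷ true ∷ []) = skew (W ∷ Y ∷ W ∷ Y ∷ []) (Z ∷ X ∷ Z ∷ X ∷ []) _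
certificate false true  (true ∷ true ∷ true ∷ true ∷ []) = skew (W ∷ W ∷ W ∷ Y ∷ []) (Z ∷ X ∷ Z ∷ X ∷ []) _
certificate true  false (false ∷ false ∷ false ∷ false ∷ []) = skew (W ∷ W ∷ W ∷ Y ∷ []) (X ∷ Z ∷ X ∷ Z ∷ []) _
certificate true  false (true ∷ false ∷ false ∷ false ∷ []) = skew (Y ∷ W ∷ Y ∷ W ∷ []) (X ∷ Z ∷ X ∷ Z ∷ []) _
certificate true  false (false ∷ true ∷ false ∷ false ∷ []) = skew (W ∷ W ∷ X ∷ Y ∷ []) (W ∷ W ∷ W ∷ Z ∷ []) _
certificate true  false (true ∷ true ∷ false ∷ false ∷ []) = symmetric (W ∷ X ∷ Y ∷ Z ∷ []) (W ∷ Y ∷ Y ∷ W ∷ []) _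
certificate true  false (false ∷ false ∷ true ∷ false ∷ []) = skew (Y ∷ W ∷ Y ∷ W ∷ []) (X ∷ Z ∷ X ∷ Z ∷ []) _
certificate true  false (true ∷ false ∷ true ∷ false ∷ []) = c5 (cyc 0F ∷ cyc 1F ∷ cyc 3F ∷ cyc 2F ∷ orb 0F ∷ []) _
certificate true  false (false ∷ true ∷ true ∷ false ∷ []) = symmetric (W ∷ X ∷ Y ∷ Z ∷ []) (W ∷ W ∷ Y ∷ Y ∷ []) _
certificate true  false (true ∷ true ∷ true ∷ false ∷ []) = skew (Y ∷ W ∷ Y ∷ W ∷ []) (Z ∷ X ∷ Z ∷ X ∷ []) _
certificate true  false (false ∷ false ∷ false ∷ true ∷ []) = skew (W ∷ W ∷ X ∷ Y ∷ []) (W ∷ Z ∷ W ∷ W ∷ []) _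
certificate true  false (true ∷ false ∷ false ∷ true ∷ []) = symmetric (W ∷ X ∷ Y ∷ Z ∷ []) (Y ∷ Y ∷ W ∷ W ∷ []) _
certificate true  false (false ∷ true ∷ false ∷ true ∷ []) = skew (W ∷ W ∷ X ∷ Y ∷ []) (Z ∷ Z ∷ Z ∷ Z ∷ []) _
certificate true  false (true ∷ true ∷ false ∷ true ∷ []) = skew (W ∷ W ∷ X ∷ Y ∷ []) (W ∷ W ∷ Z ∷ W ∷ []) _
certificate true  false (false ∷ false ∷ true ∷ true ∷ []) = symmetric (W ∷ X ∷ Y ∷ Z ∷ []) (Y ∷ W ∷ W ∷ Y ∷ []) _
certificate true  false (true ∷ false ∷ true ∷ true ∷ []) = skew (Y ∷ W ∷ Y ∷ W ∷ []) (Z ∷ X ∷ Z ∷ X ∷ []) _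
certificate true  false (false ∷ true ∷ true ∷ true ∷ []) = skew (W ∷ W ∷ X ∷ Y ∷ []) (Z ∷ W ∷ W ∷ W ∷ []) _
certificate true  false (true ∷ true ∷ true ∷ true ∷ []) = skew (W ∷ W ∷ W ∷ Y ∷ []) (Z ∷ X ∷ Z ∷ X ∷ []) _
certificate true  true  (false ∷ false ∷ false ∷ false ∷ []) = skew (W ∷ W ∷ W ∷ Y ∷ []) (X ∷ Z ∷ X ∷ Z ∷ []) _
certificate true  true  (true ∷ false ∷ false ∷ false ∷ []) = skew (W ∷ W ∷ Y ∷ X ∷ []) (W ∷ Z ∷ W ∷ W ∷ []) _
certificate true  true  (false ∷ true ∷ false ∷ false ∷ []) = skew (W ∷ Y ∷ W ∷ Y ∷ []) (X ∷ Z ∷ X ∷ Z ∷ []) _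
certificate true  true  (true ∷ true ∷ false ∷ false ∷ []) = symmetric (W ∷ X ∷ Y ∷ Z ∷ []) (W ∷ Y ∷ Y ∷ W ∷ []) _
certificate true  true  (false ∷ false ∷ true ∷ false ∷ []) = skew (W ∷ W ∷ Y ∷ X ∷ []) (W ∷ W ∷ W ∷ Z ∷ []) _
certificate true  true  (true ∷ false ∷ true ∷ false ∷ []) = skew (W ∷ W ∷ Y ∷ X ∷ []) (Z ∷ Z ∷ Z ∷ Z ∷ []) _
certificate true  true  (false ∷ true ∷ true ∷ false ∷ []) = symmetric (W ∷ X ∷ Y ∷ Z ∷ []) (W ∷ W ∷ Y ∷ Y ∷ []) _
certificate true  true  (true ∷ true ∷ true ∷ false ∷ []) = skew (W ∷ W ∷ Y ∷ X ∷ []) (W ∷ W ∷ Z ∷ W ∷ []) _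
certificate true  true  (false ∷ false ∷ false ∷ true ∷ []) = skew (W ∷ Y ∷ W ∷ Y ∷ []) (X ∷ Z ∷ X ∷ Z ∷ []) _
certificate true  true  (true ∷ false ∷ false ∷ true ∷ []) = symmetric (W ∷ X ∷ Y ∷ Z ∷ []) (Y ∷ Y ∷ W ∷ W ∷ []) _
certificate true  true  (false ∷ true ∷ false ∷ true ∷ []) = c5 (cyc 0F ∷ cyc 1F ∷ orb 0F ∷ cyc 3F ∷ cyc 2F ∷ []) _
certificate true  true  (true ∷ true ∷ false ∷ true ∷ []) = skew (W ∷ Y ∷ W ∷ Y ∷ []) (Z ∷ X ∷ Z ∷ X ∷ []) _
certificate true  true  (false ∷ false ∷ true ∷ true ∷ []) = symmetric (W ∷ X ∷ Y ∷ Z ∷ []) (Y ∷ W ∷ W ∷ Y ∷ []) _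
certificate true  true  (true ∷ false ∷ true ∷ true ∷ []) = skew (W ∷ W ∷ Y ∷ X ∷ []) (Z ∷ W ∷ W ∷ W ∷ []) _
certificate true  true  (false ∷ true ∷ true ∷ true ∷ []) = skew (W ∷ Y ∷ W ∷ Y ∷ []) (Z ∷ X ∷ Z ∷ X ∷ []) _
certificate true  true  (true ∷ true ∷ true ∷ true ∷ []) = skew (W ∷ W ∷ W ∷ Y ∷ []) (Z ∷ X ∷ Z ∷ X ∷ []) _

module Orbits {n} (G : Graph n) (τ : Permutation′ n) (anti : IsAntimorphism G τ)
  (a b : Fin n) (period : iter τ 4 a ≡ a)
  (distinct : ∀ (i j : Fin 4) → i ≢ j → iter τ (toℕ i) a ≢ iter τ (toℕ j) a)
  (disjoint : ∀ i j → iter τ i a ≢ iter τ j b)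
  (cover : ∀ v → (∃ λ i → v ≡ iter τ i a) ⊎ (∃ λ j → v ≡ iter τ j b)) where

  α : Fin 4 → Fin n
  α i = iter τ (toℕ i) a

  α-injective : ∀ {i j} → α i ≡ α j → i ≡ j
  α-injective {i} {j} αi≡αj with i ≟ j
  ... | yes i≡j = i≡j
  ... | no i≢j  = contradiction αi≡αj (distinct i j i≢j)

  flips : ∀ {u v} → u ≢ v → adj G (τ ⟨$⟩ʳ u) (τ ⟨$⟩ʳ v) ≡ not (adj G u v)
  flips = antimorphism-flips {G = G} {τ} anti

  adj-sym : ∀ u v → adj G u v ≡ adj G v u
  adj-sym = Graph.sym G

  x y : Bool
  x = adj G (α 0F) (α 1F)
  y = adj G (α 0F) (α 2F)

  adj12 : adj G (α 1F) (α 2F) ≡ not x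
  adj12 = flips (distinct 0F 1F λ ())

  adj13 : adj G (α 1F) (α 3F) ≡ not y
  adj13 = flips (distinct 0F 2F λ ())

  adj23 : adj G (α 2F) (α 3F) ≡ x
  adj23 = trans (flips (distinct 1F 2F λ ())) (trans (cong not adj12) (not-involutive x))

  adj30 : adj G (α 3F) (α 0F) ≡ not x
  adj30 = trans (cong (adj G (α 3F)) (sym period))
                (trans (flips (distinct 2F 3F λ ())) (cong not adj23))

  cycle-adj : ∀ i j → adj G (α i) (α j) ≡ cycleAdj x y i j
  cycle-adj 0F 0F = irrefl G _
  cycle-adj 0F 1F = refl
  cycle-adj 0F 2F = refl
  cycle-adj 0F 3F = trans (adj-sym _ _) adj30
  cycle-adj 1F 0F = adj-sym _ _
  cycle-adj 1F 1F = irrefl G _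
  cycle-adj 1F 2F = adj12
  cycle-adj 1F 3F = adj13
  cycle-adj 2F 0F = adj-sym _ _
  cycle-adj 2F 1F = trans (adj-sym _ _) adj12
  cycle-adj 2F 2F = irrefl G _
  cycle-adj 2F 3F = adj23
  cycle-adj 3F 0F = adj30
  cycle-adj 3F 1F = trans (adj-sym _ _) adj13
  cycle-adj 3F 2F = trans (adj-sym _ _) adj23
  cycle-adj 3F 3F = irrefl G _

  profile : Fin n → Profile
  profile v = tabulate (λ i → adj G v (α i))

  profile-entry : ∀ {v p} → profile v ≡ p → ∀ i → adj G v (α i) ≡ lookup p i
  profile-entry {v} v↦p i =
    trans (sym (lookup∘tabulate (λ k → adj G v (α k)) i)) (cong (λ p → lookup p i) v↦p)

  OffCycle : Fin n → Set
  OffCycle v = ∀ k → v ≢ α k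

  profile-step : ∀ {v} → OffCycle v → profile (τ ⟨$⟩ʳ v) ≡ rotate-not (profile v)
  profile-step off = cong₂ _∷_ (trans (cong (adj G _) (sym period)) (flips (off 3F)))
                    (cong₂ _∷_ (flips (off 0F))
                    (cong₂ _∷_ (flips (off 1F))
                    (cong (_∷ []) (flips (off 2F)))))

  orbit-off-cycle : ∀ j → OffCycle (iter τ j b)
  orbit-off-cycle j k bj≡αk = disjoint (toℕ k) j (sym bj≡αk)

  orbit-profile : ∀ j → profile (iter τ j b) ≡ iterate rotate-not j (profile b)
  orbit-profile zero    = refl
  orbit-profile (suc j) =
    trans (profile-step (orbit-off-cycle j)) (cong rotate-not (orbit-profile j))

  M : VertexType → VertexType → Maybe Bool
  M = modelAdj x y (profile b)

  Realizes : Fin n → VertexType → Set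
  Realizes v (cyc i) = v ≡ α i
  Realizes v (orb c) = OffCycle v × profile v ≡ rotations (profile b) c

  sound : ∀ {u v s t w} → Realizes u s → Realizes v t → M s t ≡ just w → adj G u v ≡ w
  sound {s = cyc i} {cyc j} refl refl refl = cycle-adj i j
  sound {s = cyc i} {orb c} refl (_ , v↦c) refl = trans (adj-sym _ _) (profile-entry v↦c i)
  sound {s = orb c} {cyc i} (_ , u↦c) refl refl = profile-entry u↦c i
  sound {s = orb _} {orb _} _ _ ()

  realizer : ∀ t → ∃ λ v → Realizes v t
  realizer (cyc i) = α i , refl
  realizer (orb c) = iter τ (toℕ c) b , orbit-off-cycle (toℕ c) , orbit-profile (toℕ c)

  cycle-position : ∀ i → ∃ λ k → iter τ i a ≡ α k
  cycle-position = period-4-values (τ ⟨$⟩ʳ_) (λ i → iter τ i a) (λ _ → refl) period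

  orbit-class : ∀ j → ∃ λ c → iterate rotate-not j (profile b) ≡ rotations (profile b) c
  orbit-class = period-4-values rotate-not (λ j → iterate rotate-not j (profile b))
                                (λ _ → refl) (rotate-not⁴ (profile b))

  classify : ∀ v → Σ VertexType (Realizes v)
  classify v with any? (λ k → v ≟ α k) | cover v
  ... | yes (k , v≡αk) | _            = cyc k , v≡αk
  ... | no off         | inj₁ (i , v≡aᵢ) =
    let (k , aᵢ≡αk) = cycle-position i in contradiction (k , trans v≡aᵢ aᵢ≡αk) off
  ... | no off         | inj₂ (j , v≡bⱼ) =
    let (c , bⱼ↦c) = orbit-class j
    in orb c , (λ k v≡αk → off (k , v≡αk)) ,
       trans (cong profile v≡bⱼ) (trans (orbit-profile j) bⱼ↦c)

  module _ (cycPart orbPart : Vec (Fin 4) 4) (compatible : Compatible (profile b) orbPart) where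

    partition-respects : ∀ {v s t} → Realizes v s → Realizes v t →
      partition cycPart orbPart s ≡ partition cycPart orbPart t
    partition-respects {s = cyc i} {cyc j} v≡αi v≡αj =
      cong (lookup cycPart) (α-injective (trans (sym v≡αi) v≡αj))
    partition-respects {s = cyc i} {orb c} v≡αi (off , _) = contradiction v≡αi (off i)
    partition-respects {s = orb c} {cyc i} (off , _) v≡αi = contradiction v≡αi (off i)
    partition-respects {s = orb c} {orb d} (_ , v↦c) (_ , v↦d) =
      compatible c d (trans (sym v↦c) v↦d)

  open Lifting G M Realizes sound realizer classify

  from-certificate : Certificate x y (profile b) →
    HasInducedC5 G ⊎ (HasSkewPartition G ⊎ HasSymmetricPartition G)
  from-certificate (c5 f ok) = inj₁ (lift-C5 (lookup f) (toWitness ok))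
  from-certificate (skew cycPart orbPart ok) =
    let (compatible , model) = toWitness ok
    in inj₂ (inj₁ (lift-skew (partition cycPart orbPart)
                     (partition-respects cycPart orbPart compatible) model))
  from-certificate (symmetric cycPart orbPart ok) =
    let (compatible , model) = toWitness ok
    in inj₂ (inj₂ (lift-symmetric (partition cycPart orbPart)
                     (partition-respects cycPart orbPart compatible) model))

theorem5 : (n : ℕ) (G : Graph n) (τ : Permutation′ n) →
    IsAntimorphism G τ → TwoCyclesOneOfLength4 τ →
    HasInducedC5 G ⊎ (HasSkewPartition G ⊎ HasSymmetricPartition G)
theorem5 n G τ anti (a , b , period , distinct , disjoint , cover) =
  from-certificate (certificate x y (profile b))
  where open Orbits G τ anti a b period distinct disjoint cover
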